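{- Let $n=2m\ge4$, $p$ an odd prime and $q$ a power of $p$. Let $\Omega_n(q)$ be the set of $(a_1,\ldots,a_n)\in\mathbb{F}_q^n$ with $M_n(a_1,\ldots,a_n)=\mathrm{Id}$, and let $\widehat{\Omega}_n(q)$ be the set of orbits of the action of $\mathbb{F}_q^{*}$ on $\Omega_n(q)$ given by $\lambda\cdot(a_1,\ldots,a_{2m})=(\lambda a_1,\lambda^{ -1}a_2,\ldots,\lambda a_{2m-1},\lambda^{ -1}a_{2m})$. Then: if $m$ is even, $|\Omega_n(q)|=1+(q-1)(|\widehat{\Omega}_n(q)|-1)$; if $m$ is odd, $|\Omega_n(q)|=(q-1)|\widehat{\Omega}_n(q)|$.
   Context: $M_1(a)=\begin{pmatrix} a&-1\\ 1&0\end{pmatrix}$ and $M_n(a_1,\ldots,a_n)=M_1(a_n)\cdots M_1(a_1)$. The given formula defines an action of $\mathbb{F}_q^{*}$ on $\Omega_n(q)$ (i.e. it preserves $\Omega_n(q)$). -}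

module Defs where

open import Data.Nat using (ℕ; zero; suc)
open import Data.Fin using (Fin)
open import Data.Vec using (Vec; []; _∷_)
open import Data.Product using (Σ; ∃; _×_; _,_)
open import Function.Bundles using (_↔_; _⇔_)
open import Function.Definitions using (Surjective)
open import Relation.Binary.PropositionalEquality using (_≡_; _≢_)
open import Algebra.Structures using (IsCommutativeRing)

record FiniteField : Set₁ where
  infixl 6 _+_
  infixl 7 _*_
  field
    Carrier : Set
    _+_ _*_ : Carrier → Carrier → Carrier
    -_ : Carrier → Carrier
    0# 1# : Carrier
    isCommutativeRing : IsCommutativeRing _≡_ _+_ _*_ -_ 0# 1#
    0≢1 : 0# ≢ 1#
    inverse : ∀ x → x ≢ 0# → Σ Carrier (λ y → x * y ≡ 1#)
    size : ℕ
    enum : Carrier ↔ Fin size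

module _ (F : FiniteField) where
  open FiniteField F

  record Mat : Set where
    constructor mat
    field
      r11 r12 r21 r22 : Carrier

  Id₂ : Mat
  Id₂ = mat 1# 0# 0# 1#

  _·_ : Mat → Mat → Mat
  mat a b c d · mat e f g h =
    mat (a * e + b * g) (a * f + b * h) (c * e + d * g) (c * f + d * h)

  M₁ : Carrier → Mat
  M₁ a = mat a (- 1#) 1# 0#

  Mₙ : ∀ {n} → Vec Carrier n → Mat
  Mₙ [] = Id₂
  Mₙ (a ∷ as) = Mₙ as · M₁ a

  Ω : ℕ → Set
  Ω n = Σ (Vec Carrier n) (λ a → Mₙ a ≡ Id₂)

  -- the action of λ ∈ F* (with inverse μ) :
  -- (a_1, a_2, a_3, ...) ↦ (λ a_1, μ a_2, λ a_3, ...)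
  act : ∀ {n} → Carrier → Carrier → Vec Carrier n → Vec Carrier n
  act l u [] = []
  act l u (a ∷ as) = l * a ∷ act u l as

  SameOrbit : ∀ {n} → Ω n → Ω n → Set
  SameOrbit (a , _) (b , _) =
    ∃ λ l → ∃ λ u → (l * u ≡ 1#) × (act l u a ≡ b)

  -- K is the number of orbits: a surjection onto Fin K whose fibres
  -- are exactly the orbits (i.e. Ω/F* ≅ Fin K)
  OrbitCount : ℕ → ℕ → Set
  OrbitCount n K =
    Σ (Ω n → Fin K) λ cls →
      Surjective _≡_ _≡_ cls ×
      (∀ x y → (cls x ≡ cls y) ⇔ SameOrbit x y)

module Submission where

-- Writing λ · a for the action, M(λ · a) = diag(λ⁻¹,1) M(a) diag(λ,1) for vectors of even length,
-- so the action preserves Ω. It is free away from the zero vector, since the first nonzero entry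
-- of a vector determines λ. The zero vector is fixed, and M(0,…,0) = (-1)^m Id; as q is odd and
-- q · 1 = 0 in F, we have -1 ≠ 1, so the zero vector lies in Ω exactly when m is even. Hence,
-- with Z = [0 ∈ Ω], Ω ⊎ Z × F* ≅ Z ⊎ (Ω/F*) × F*, and counting gives both formulas.

open import Defs
open import Algebra.Bundles using (CommutativeRing)
open import Algebra.Structures using (IsCommutativeRing)
open import Data.Bool.Properties using (T-irrelevant)
open import Data.Empty using (⊥-elim)
open import Data.Fin as Fin using (Fin; punchIn; punchOut)
open import Data.Fin.Permutation using (Permutation; _⟨$⟩ʳ_; ↔⇒≡)
open import Data.Fin.Properties
  using (¬Fin0; punchInᵢ≢i; punchOut-cong; punchOut-punchIn; punchIn-punchOut; +↔⊎; *↔×)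
open import Data.Maybe using (nothing)
open import Data.Nat as ℕ using (ℕ; zero; suc; _∸_; _^_; _≤_)
open import Data.Nat.Divisibility using (_∣_; divides; ∣1⇒≡1)
open import Data.Nat.Primality using (Prime; prime[2]; euclidsLemma; prime⇒irreducible)
import Data.Nat.Properties as ℕ
open import Data.Product using (Σ; ∃-syntax; _×_; _,_; proj₁; proj₂)
open import Data.Product.Properties using (Σ-≡,≡→≡)
open import Data.Product.Function.NonDependent.Propositional using (_×-↔_)
open import Data.Sum using (_⊎_; inj₁; inj₂)
open import Data.Sum.Function.Propositional using (_⊎-↔_)
open import Data.Vec using (Vec; []; _∷_; replicate)
open import Data.Vec.Properties using (∷-injectiveˡ; ∷-injectiveʳ; ≡-dec)
open import Function.Bundles using (Inverse; Injection; Equivalence; _↔_; _⇔_; mk↔ₛ′)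
open import Function.Construct.Composition using (_↔-∘_)
open import Function.Construct.Identity using (↔-id)
open import Function.Construct.Symmetry using (↔-sym)
open import Function.Properties.Inverse using (↔⇒↣)
open import Relation.Binary.Definitions using (DecidableEquality)
open import Relation.Binary.PropositionalEquality
open import Relation.Binary.PropositionalEquality.WithK using (≡-irrelevant)
open import Relation.Nullary using (¬_; Dec; yes; no; Irrelevant)
open import Relation.Nullary.Decidable using (False; toWitnessFalse; fromWitnessFalse; via-injection)

even⊎odd : ∀ n → 2 ∣ n ⊎ ∃[ t ] n ≡ suc (t ℕ.* 2)
even⊎odd zero = inj₁ (divides 0 refl)
even⊎odd (suc n) with even⊎odd n
... | inj₁ (divides t refl) = inj₂ (t , refl)
... | inj₂ (t , refl) = inj₁ (divides (suc t) refl)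

¬2∣⇒odd : ∀ {n} → ¬ 2 ∣ n → ∃[ t ] n ≡ suc (t ℕ.* 2)
¬2∣⇒odd {n} 2∤n with even⊎odd n
... | inj₁ 2∣n = ⊥-elim (2∤n 2∣n)
... | inj₂ odd = odd

prime≢2⇒¬2∣ : ∀ {p} → Prime p → p ≢ 2 → ¬ 2 ∣ p
prime≢2⇒¬2∣ p-prime p≢2 2∣p with prime⇒irreducible p-prime 2∣p
... | inj₁ ()
... | inj₂ 2≡p = p≢2 (sym 2≡p)

¬2∣⇒¬2∣^ : ∀ {p} → ¬ 2 ∣ p → ∀ k → ¬ 2 ∣ p ^ k
¬2∣⇒¬2∣^ 2∤p zero 2∣1 with ∣1⇒≡1 2∣1
... | ()
¬2∣⇒¬2∣^ {p} 2∤p (suc k) 2∣p^1+k with euclidsLemma p (p ^ k) prime[2] 2∣p^1+k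
... | inj₁ 2∣p = 2∤p 2∣p
... | inj₂ 2∣p^k = ¬2∣⇒¬2∣^ 2∤p k 2∣p^k

inhabited↔Fin1 : ∀ {A : Set} → Irrelevant A → A → A ↔ Fin 1
inhabited↔Fin1 irr a =
  mk↔ₛ′ (λ _ → Fin.zero) (λ _ → a) (λ { Fin.zero → refl ; (Fin.suc ()) }) (irr a)

empty↔Fin0 : ∀ {A : Set} → ¬ A → A ↔ Fin 0
empty↔Fin0 ¬a = mk↔ₛ′ (λ a → ⊥-elim (¬a a)) (λ ()) (λ ()) (λ a → ⊥-elim (¬a a))

⊎×↔Fin : ∀ {A B C : Set} {a b c} → A ↔ Fin a → B ↔ Fin b → C ↔ Fin c →
         (A ⊎ (B × C)) ↔ Fin (a ℕ.+ b ℕ.* c)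
⊎×↔Fin A↔a B↔b C↔c = ↔-sym ((↔-sym A↔a ⊎-↔ (↔-sym (B↔b ×-↔ C↔c) ↔-∘ *↔×)) ↔-∘ +↔⊎)

module _ {A : Set} (_≟_ : DecidableEquality A) where

  -- False rather than ≢ keeps the second component proof-irrelevant.
  Punctured : A → Set
  Punctured a = Σ A λ x → False (x ≟ a)

  punctured-≡ : ∀ {a} {x y : Punctured a} → proj₁ x ≡ proj₁ y → x ≡ y
  punctured-≡ refl = Σ-≡,≡→≡ (refl , T-irrelevant _ _)

  punctured↔Fin : ∀ {n} → A ↔ Fin n → (a : A) → Punctured a ↔ Fin (n ∸ 1)
  punctured↔Fin {zero} e a = ⊥-elim (¬Fin0 (Inverse.to e a))
  punctured↔Fin {suc n} e a = mk↔ₛ′ to from to∘from from∘to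
    where
    open Inverse e renaming (to to index; from to element)
    index-injective : ∀ {x y} → index x ≡ index y → x ≡ y
    index-injective = Injection.injective (↔⇒↣ e)

    i : Fin (suc n)
    i = index a

    i≢index : ∀ {x} → False (x ≟ a) → i ≢ index x
    i≢index x≢a i≡ix = toWitnessFalse x≢a (sym (index-injective i≡ix))

    to : Punctured a → Fin n
    to (x , x≢a) = punchOut (i≢index x≢a)

    from : Fin n → Punctured a
    from j = element (punchIn i j) , fromWitnessFalse λ x≡a →
      punchInᵢ≢i i j (trans (sym (strictlyInverseˡ _)) (cong index x≡a))

    to∘from : ∀ j → to (from j) ≡ j
    to∘from j = trans (punchOut-cong i (strictlyInverseˡ (punchIn i j))) (punchOut-punchIn i)

    from∘to : ∀ x → from (to x) ≡ x
    from∘to (x , x≢a) = punctured-≡ (trans (cong element (punchIn-punchOut _)) (strictlyInverseʳ x))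

module _ (F : FiniteField) where
  open FiniteField F
  open IsCommutativeRing isCommutativeRing
    using (+-assoc; +-identityˡ; +-identityʳ; -‿inverseˡ; -‿inverseʳ;
           *-assoc; *-comm; *-identityˡ; *-identityʳ; zeroˡ; zeroʳ)

  commutativeRing : CommutativeRing _ _
  commutativeRing = record { isCommutativeRing = isCommutativeRing }

  open CommutativeRing commutativeRing using (ring; +-monoid; +-commutativeMonoid; commutativeSemiring)
  open import Algebra.Properties.Ring ring
    using (-‿distribʳ-*; -‿involutive; +-identityʳ-unique)
  open import Algebra.Properties.CommutativeMonoid.Sum +-commutativeMonoid
    using (sum; sum-permute; ∑-distrib-+; sum-cong-≗; sum-replicate)
  open import Algebra.Properties.Monoid.Mult +-monoid using () renaming (_×_ to _×ᵤ_)
  open import Algebra.Solver.Ring.NaturalCoefficients commutativeSemiring (λ _ _ → nothing)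
    using (solve; _:=_; _:+_; _:*_)
  open ≡-Reasoning

  _≟_ : DecidableEquality Carrier
  _≟_ = via-injection (↔⇒↣ enum) Fin._≟_

  Units : Set
  Units = Punctured _≟_ 0#

  _⁻¹ : Units → Carrier
  (x , x≢0) ⁻¹ = proj₁ (inverse x (toWitnessFalse x≢0))

  ·⁻¹≡1 : (x : Units) → proj₁ x * x ⁻¹ ≡ 1#
  ·⁻¹≡1 (x , x≢0) = proj₂ (inverse x (toWitnessFalse x≢0))

  unit≢0 : ∀ {l u} → l * u ≡ 1# → l ≢ 0#
  unit≢0 {l} {u} lu≡1 l≡0 = 0≢1 (begin
    0#     ≡⟨ sym (zeroˡ u) ⟩
    0# * u ≡⟨ cong (_* u) (sym l≡0) ⟩
    l * u  ≡⟨ lu≡1 ⟩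
    1#     ∎)

  unit : ∀ {l u} → l * u ≡ 1# → Units
  unit {l} lu≡1 = l , fromWitnessFalse (unit≢0 lu≡1)

  inverse-unique : ∀ {l u u′} → l * u ≡ 1# → l * u′ ≡ 1# → u ≡ u′
  inverse-unique {l} {u} {u′} lu≡1 lu′≡1 = begin
    u            ≡⟨ sym (*-identityʳ u) ⟩
    u * 1#       ≡⟨ cong (u *_) (sym lu′≡1) ⟩
    u * (l * u′) ≡⟨ sym (*-assoc u l u′) ⟩
    u * l * u′   ≡⟨ cong (_* u′) (trans (*-comm u l) lu≡1) ⟩
    1# * u′      ≡⟨ *-identityˡ u′ ⟩
    u′           ∎

  *-cancelʳ : ∀ {a l l′} → a ≢ 0# → l * a ≡ l′ * a → l ≡ l′
  *-cancelʳ {a} {l} {l′} a≢0 la≡l′a = begin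
    l            ≡⟨ sym (*-identityʳ l) ⟩
    l * 1#       ≡⟨ cong (l *_) (sym ab≡1) ⟩
    l * (a * b)  ≡⟨ sym (*-assoc l a b) ⟩
    l * a * b    ≡⟨ cong (_* b) la≡l′a ⟩
    l′ * a * b   ≡⟨ *-assoc l′ a b ⟩
    l′ * (a * b) ≡⟨ cong (l′ *_) ab≡1 ⟩
    l′ * 1#      ≡⟨ *-identityʳ l′ ⟩
    l′           ∎
    where
    b : Carrier
    b = proj₁ (inverse a a≢0)
    ab≡1 : a * b ≡ 1#
    ab≡1 = proj₂ (inverse a a≢0)

  -- Σ x = Σ (x + 1) = Σ x + q · 1, summing over the enumeration of F.
  size×1≡0 : size ×ᵤ 1# ≡ 0#
  size×1≡0 = +-identityʳ-unique (sum element) (size ×ᵤ 1#) (begin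
    sum element + size ×ᵤ 1#
      ≡⟨ cong (sum element +_) (sym (sum-replicate size)) ⟩
    sum element + sum {size} (λ _ → 1#)
      ≡⟨ sym (∑-distrib-+ element (λ _ → 1#)) ⟩
    sum (λ i → element i + 1#)
      ≡⟨ sum-cong-≗ (λ i → sym (strictlyInverseʳ (element i + 1#))) ⟩
    sum (λ i → element (successor ⟨$⟩ʳ i))
      ≡⟨ sym (sum-permute element successor) ⟩
    sum element
      ∎)
    where
    open Inverse enum using (strictlyInverseʳ) renaming (from to element)

    +1↔ : Carrier ↔ Carrier
    +1↔ = mk↔ₛ′ (_+ 1#) (_+ - 1#) (λ x → cancel x (-‿inverseˡ 1#)) (λ x → cancel x (-‿inverseʳ 1#))
      where
      cancel : ∀ x {a b} → b + a ≡ 0# → x + b + a ≡ x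
      cancel x {a} {b} b+a≡0 = begin
        x + b + a   ≡⟨ +-assoc x b a ⟩
        x + (b + a) ≡⟨ cong (x +_) b+a≡0 ⟩
        x + 0#      ≡⟨ +-identityʳ x ⟩
        x           ∎

    successor : Permutation size size
    successor = enum ↔-∘ (+1↔ ↔-∘ ↔-sym enum)

  1+1≢0 : ¬ 2 ∣ size → 1# + 1# ≢ 0#
  1+1≢0 2∤size 1+1≡0 with ¬2∣⇒odd 2∤size
  ... | t , size≡1+2t = 0≢1 (begin
    0#                     ≡⟨ sym size×1≡0 ⟩
    size ×ᵤ 1#             ≡⟨ cong (_×ᵤ 1#) size≡1+2t ⟩
    1# + (t ℕ.* 2) ×ᵤ 1#   ≡⟨ cong (1# +_) (even×1≡0 t) ⟩
    1# + 0#                ≡⟨ +-identityʳ 1# ⟩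
    1#                     ∎)
    where
    even×1≡0 : ∀ t → (t ℕ.* 2) ×ᵤ 1# ≡ 0#
    even×1≡0 zero = refl
    even×1≡0 (suc t) = begin
      1# + (1# + (t ℕ.* 2) ×ᵤ 1#)  ≡⟨ sym (+-assoc 1# 1# _) ⟩
      1# + 1# + (t ℕ.* 2) ×ᵤ 1#    ≡⟨ cong₂ _+_ 1+1≡0 (even×1≡0 t) ⟩
      0# + 0#                      ≡⟨ +-identityˡ 0# ⟩
      0#                           ∎

  infixl 7 _∙_
  _∙_ : Mat F → Mat F → Mat F
  _∙_ = _·_ F

  mat-cong : ∀ {x y z w x′ y′ z′ w′} → x ≡ x′ → y ≡ y′ → z ≡ z′ → w ≡ w′ →
             _≡_ {A = Mat F} (mat x y z w) (mat x′ y′ z′ w′)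
  mat-cong refl refl refl refl = refl

  ∙M₁ : ∀ x y z w a → mat x y z w ∙ M₁ F a ≡ mat (x * a + y) (- x) (z * a + w) (- z)
  ∙M₁ x y z w a = mat-cong (cong (x * a +_) (*-identityʳ y)) (x*-1+y*0 x y)
                           (cong (z * a +_) (*-identityʳ w)) (x*-1+y*0 z w)
    where
    x*-1+y*0 : ∀ x y → x * - 1# + y * 0# ≡ - x
    x*-1+y*0 x y = begin
      x * - 1# + y * 0#  ≡⟨ cong₂ _+_ (sym (-‿distribʳ-* x 1#)) (zeroʳ y) ⟩
      - (x * 1#) + 0#    ≡⟨ +-identityʳ _ ⟩
      - (x * 1#)         ≡⟨ cong -_ (*-identityʳ x) ⟩
      - x                ∎

  -- rescale n l u X = D X diag(l,1), where D = diag(u,1) for even n and D = diag(1,u) for odd n.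
  rescale : ℕ → Carrier → Carrier → Mat F → Mat F
  rescale zero          l u (mat x y z w) = mat x (u * y) (l * z) w
  rescale (suc zero)    l u (mat x y z w) = mat (l * x) y z (u * w)
  rescale (suc (suc n)) l u = rescale n l u

  rescale-Id : ∀ l u → rescale 0 l u (Id₂ F) ≡ Id₂ F
  rescale-Id l u = mat-cong refl (zeroʳ u) (zeroʳ l) refl

  rescale-2* : ∀ m → rescale (2 ℕ.* m) ≡ rescale 0
  rescale-2* zero = refl
  rescale-2* (suc m) rewrite ℕ.*-suc 2 m = rescale-2* m

  factorˡ : ∀ l x a y → x * (l * a) + l * y ≡ l * (x * a + y)
  factorˡ = solve 4 (λ l x a y → x :* (l :* a) :+ l :* y := l :* (x :* a :+ y)) refl

  cancel-unit : ∀ {l u} → l * u ≡ 1# → ∀ x a → u * x * (l * a) ≡ x * a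
  cancel-unit {l} {u} lu≡1 x a = begin
    u * x * (l * a)  ≡⟨ solve 4 (λ l u x a → u :* x :* (l :* a) := l :* u :* (x :* a)) refl l u x a ⟩
    l * u * (x * a)  ≡⟨ cong (_* (x * a)) lu≡1 ⟩
    1# * (x * a)     ≡⟨ *-identityˡ (x * a) ⟩
    x * a            ∎

  rescale-∙M₁ : ∀ {l u} → l * u ≡ 1# → ∀ n X a →
                rescale n u l X ∙ M₁ F (l * a) ≡ rescale (suc n) l u (X ∙ M₁ F a)
  rescale-∙M₁ {l} {u} lu≡1 zero (mat x y z w) a = begin
    mat x (l * y) (u * z) w ∙ M₁ F (l * a)
      ≡⟨ ∙M₁ x (l * y) (u * z) w (l * a) ⟩
    mat (x * (l * a) + l * y) (- x) (u * z * (l * a) + w) (- (u * z))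
      ≡⟨ mat-cong (factorˡ l x a y) refl (cong (_+ w) (cancel-unit lu≡1 z a)) (-‿distribʳ-* u z) ⟩
    rescale 1 l u (mat (x * a + y) (- x) (z * a + w) (- z))
      ≡⟨ cong (rescale 1 l u) (∙M₁ x y z w a) ⟨
    rescale 1 l u (mat x y z w ∙ M₁ F a)
      ∎
  rescale-∙M₁ {l} {u} lu≡1 (suc zero) (mat x y z w) a = begin
    mat (u * x) y z (l * w) ∙ M₁ F (l * a)
      ≡⟨ ∙M₁ (u * x) y z (l * w) (l * a) ⟩
    mat (u * x * (l * a) + y) (- (u * x)) (z * (l * a) + l * w) (- z)
      ≡⟨ mat-cong (cong (_+ y) (cancel-unit lu≡1 x a)) (-‿distribʳ-* u x) (factorˡ l z a w) refl ⟩
    rescale 0 l u (mat (x * a + y) (- x) (z * a + w) (- z))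
      ≡⟨ cong (rescale 0 l u) (∙M₁ x y z w a) ⟨
    rescale 0 l u (mat x y z w ∙ M₁ F a)
      ∎
  rescale-∙M₁ lu≡1 (suc (suc n)) = rescale-∙M₁ lu≡1 n

  Mₙ-act : ∀ {n l u} → l * u ≡ 1# → (as : Vec Carrier n) →
           Mₙ F (act F l u as) ≡ rescale n l u (Mₙ F as)
  Mₙ-act {l = l} {u} lu≡1 [] = sym (rescale-Id l u)
  Mₙ-act {suc n} {l} {u} lu≡1 (a ∷ as) = begin
    Mₙ F (act F u l as) ∙ M₁ F (l * a)
      ≡⟨ cong (_∙ M₁ F (l * a)) (Mₙ-act (trans (*-comm u l) lu≡1) as) ⟩
    rescale n u l (Mₙ F as) ∙ M₁ F (l * a)
      ≡⟨ rescale-∙M₁ lu≡1 n (Mₙ F as) a ⟩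
    rescale (suc n) l u (Mₙ F as ∙ M₁ F a)
      ∎

  act-preserves-Ω : ∀ m {l u} → l * u ≡ 1# → (as : Vec Carrier (2 ℕ.* m)) →
                    Mₙ F as ≡ Id₂ F → Mₙ F (act F l u as) ≡ Id₂ F
  act-preserves-Ω m {l} {u} lu≡1 as as∈Ω = begin
    Mₙ F (act F l u as)             ≡⟨ Mₙ-act lu≡1 as ⟩
    rescale (2 ℕ.* m) l u (Mₙ F as) ≡⟨ cong (λ r → r l u (Mₙ F as)) (rescale-2* m) ⟩
    rescale 0 l u (Mₙ F as)         ≡⟨ cong (rescale 0 l u) as∈Ω ⟩
    rescale 0 l u (Id₂ F)           ≡⟨ rescale-Id l u ⟩
    Id₂ F                           ∎

  negate : Mat F → Mat F
  negate (mat x y z w) = mat (- x) (- y) (- z) (- w)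

  negate-involutive : ∀ X → negate (negate X) ≡ X
  negate-involutive (mat x y z w) =
    mat-cong (-‿involutive x) (-‿involutive y) (-‿involutive z) (-‿involutive w)

  ∙M₁0∙M₁0 : ∀ X → X ∙ M₁ F 0# ∙ M₁ F 0# ≡ negate X
  ∙M₁0∙M₁0 (mat x y z w) = begin
    mat x y z w ∙ M₁ F 0# ∙ M₁ F 0#
      ≡⟨ cong (_∙ M₁ F 0#) (∙M₁ x y z w 0#) ⟩
    mat (x * 0# + y) (- x) (z * 0# + w) (- z) ∙ M₁ F 0#
      ≡⟨ ∙M₁ (x * 0# + y) (- x) (z * 0# + w) (- z) 0# ⟩
    mat ((x * 0# + y) * 0# + - x) (- (x * 0# + y)) ((z * 0# + w) * 0# + - z) (- (z * 0# + w))
      ≡⟨ mat-cong (*0+ _ (- x)) (cong -_ (*0+ x y)) (*0+ _ (- z)) (cong -_ (*0+ z w)) ⟩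
    negate (mat x y z w)
      ∎
    where
    *0+ : ∀ a b → a * 0# + b ≡ b
    *0+ a b = trans (cong (_+ b) (zeroʳ a)) (+-identityˡ b)

  Mₙ-zeros-2+ : ∀ n → Mₙ F (replicate (2 ℕ.+ n) 0#) ≡ negate (Mₙ F (replicate n 0#))
  Mₙ-zeros-2+ n = ∙M₁0∙M₁0 (Mₙ F (replicate n 0#))

  Mₙ-zeros-*4 : ∀ t → Mₙ F (replicate (t ℕ.* 4) 0#) ≡ Id₂ F
  Mₙ-zeros-*4 zero = refl
  Mₙ-zeros-*4 (suc t) = begin
    Mₙ F (replicate (4 ℕ.+ t ℕ.* 4) 0#)           ≡⟨ Mₙ-zeros-2+ (2 ℕ.+ t ℕ.* 4) ⟩
    negate (Mₙ F (replicate (2 ℕ.+ t ℕ.* 4) 0#))  ≡⟨ cong negate (Mₙ-zeros-2+ (t ℕ.* 4)) ⟩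
    negate (negate (Mₙ F (replicate (t ℕ.* 4) 0#))) ≡⟨ negate-involutive _ ⟩
    Mₙ F (replicate (t ℕ.* 4) 0#)                 ≡⟨ Mₙ-zeros-*4 t ⟩
    Id₂ F                                         ∎

  2*[t*2]≡t*4 : ∀ t → 2 ℕ.* (t ℕ.* 2) ≡ t ℕ.* 4
  2*[t*2]≡t*4 t = trans (ℕ.*-comm 2 (t ℕ.* 2)) (ℕ.*-assoc t 2 2)

  zeros∈Ω : ∀ {m} → 2 ∣ m → Mₙ F (replicate (2 ℕ.* m) 0#) ≡ Id₂ F
  zeros∈Ω (divides t refl) =
    subst (λ n → Mₙ F (replicate n 0#) ≡ Id₂ F) (sym (2*[t*2]≡t*4 t)) (Mₙ-zeros-*4 t)

  zeros∉Ω : ∀ {m} → 1# + 1# ≢ 0# → ¬ 2 ∣ m → Mₙ F (replicate (2 ℕ.* m) 0#) ≢ Id₂ F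
  zeros∉Ω {m} 1+1≢0 2∤m Mₙ-zeros≡Id with ¬2∣⇒odd 2∤m
  ... | t , refl = 1+1≢0 (begin
    1# + 1#    ≡⟨ cong (1# +_) (sym -1≡1) ⟩
    1# + - 1#  ≡⟨ -‿inverseʳ 1# ⟩
    0#         ∎)
    where
    2*m≡2+t*4 : 2 ℕ.* m ≡ 2 ℕ.+ t ℕ.* 4
    2*m≡2+t*4 = trans (ℕ.*-suc 2 (t ℕ.* 2)) (cong (2 ℕ.+_) (2*[t*2]≡t*4 t))
    -Id≡Id : negate (Id₂ F) ≡ Id₂ F
    -Id≡Id = begin
      negate (Id₂ F)                                   ≡⟨ cong negate (Mₙ-zeros-*4 t) ⟨
      negate (Mₙ F (replicate (t ℕ.* 4) 0#))           ≡⟨ Mₙ-zeros-2+ (t ℕ.* 4) ⟨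
      Mₙ F (replicate (2 ℕ.+ t ℕ.* 4) 0#)              ≡⟨ cong (λ n → Mₙ F (replicate n 0#)) 2*m≡2+t*4 ⟨
      Mₙ F (replicate (2 ℕ.* m) 0#)                    ≡⟨ Mₙ-zeros≡Id ⟩
      Id₂ F                                            ∎
    -1≡1 : - 1# ≡ 1#
    -1≡1 = cong Mat.r11 -Id≡Id

  act-zeros : ∀ {n} l u → act F l u (replicate n 0#) ≡ replicate n 0#
  act-zeros {zero} l u = refl
  act-zeros {suc n} l u = cong₂ _∷_ (zeroʳ l) (act-zeros u l)

  act-injective : ∀ {n l u l′ u′} → l * u ≡ 1# → l′ * u′ ≡ 1# → (as : Vec Carrier n) →
                  as ≢ replicate n 0# → act F l u as ≡ act F l′ u′ as → l ≡ l′
  act-injective lu≡1 l′u′≡1 [] []≢[] _ = ⊥-elim ([]≢[] refl)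
  act-injective {l = l} {u} {l′} {u′} lu≡1 l′u′≡1 (a ∷ as) a∷as≢0 act≡act with a ≟ 0#
  ... | no a≢0 = *-cancelʳ a≢0 (∷-injectiveˡ act≡act)
  ... | yes refl = inverse-unique ul≡1 (subst (λ v → v * l′ ≡ 1#) (sym u≡u′) u′l′≡1)
    where
    ul≡1 : u * l ≡ 1#
    ul≡1 = trans (*-comm u l) lu≡1
    u′l′≡1 : u′ * l′ ≡ 1#
    u′l′≡1 = trans (*-comm u′ l′) l′u′≡1
    u≡u′ : u ≡ u′
    u≡u′ = act-injective ul≡1 u′l′≡1 as
             (λ as≡0 → a∷as≢0 (cong (0# ∷_) as≡0)) (∷-injectiveʳ act≡act)

  module OrbitDecomposition
    {n K : ℕ}
    (act-preserves : ∀ {l u} → l * u ≡ 1# → (as : Vec Carrier n) →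
                     Mₙ F as ≡ Id₂ F → Mₙ F (act F l u as) ≡ Id₂ F)
    (orbits : OrbitCount F n K)
    where

    zeros : Vec Carrier n
    zeros = replicate n 0#

    ZeroInΩ : Set
    ZeroInΩ = Mₙ F zeros ≡ Id₂ F

    cls : Ω F n → Fin K
    cls = proj₁ orbits

    same-class⇔same-orbit : ∀ ω ω′ → (cls ω ≡ cls ω′) ⇔ SameOrbit F ω ω′
    same-class⇔same-orbit = proj₂ (proj₂ orbits)

    rep : Fin K → Ω F n
    rep c = proj₁ (proj₁ (proj₂ orbits) c)

    cls-rep : ∀ c → cls (rep c) ≡ c
    cls-rep c = proj₂ (proj₁ (proj₂ orbits) c) refl

    Ω-≡ : {ω ω′ : Ω F n} → proj₁ ω ≡ proj₁ ω′ → ω ≡ ω′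
    Ω-≡ {_ , _} {_ , _} refl = Σ-≡,≡→≡ (refl , ≡-irrelevant _ _)

    zeroInΩ : (ω : Ω F n) → proj₁ ω ≡ zeros → ZeroInΩ
    zeroInΩ (_ , as∈Ω) refl = as∈Ω

    zero-class : ∀ ω ω′ → proj₁ ω ≡ zeros → cls ω ≡ cls ω′ → proj₁ ω′ ≡ zeros
    zero-class ω ω′ ω≡0 cls≡cls with Equivalence.to (same-class⇔same-orbit ω ω′) cls≡cls
    ... | l , u , _ , act≡ω′ = begin
      proj₁ ω′               ≡⟨ act≡ω′ ⟨
      act F l u (proj₁ ω)    ≡⟨ cong (act F l u) ω≡0 ⟩
      act F l u zeros        ≡⟨ act-zeros l u ⟩
      zeros                  ∎

    _•_ : Units → Ω F n → Ω F n
    x • (as , as∈Ω) = act F (proj₁ x) (x ⁻¹) as , act-preserves (·⁻¹≡1 x) as as∈Ω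

    cls-• : ∀ x ω → cls (x • ω) ≡ cls ω
    cls-• x ω =
      sym (Equivalence.from (same-class⇔same-orbit ω (x • ω)) (proj₁ x , x ⁻¹ , ·⁻¹≡1 x , refl))

    •-injective : ∀ {x y} ω → proj₁ ω ≢ zeros → x • ω ≡ y • ω → x ≡ y
    •-injective {x} {y} (as , _) as≢0 x•ω≡y•ω =
      punctured-≡ _≟_ (act-injective (·⁻¹≡1 x) (·⁻¹≡1 y) as as≢0 (cong proj₁ x•ω≡y•ω))

    orbit-of : ∀ ω → SameOrbit F (rep (cls ω)) ω
    orbit-of ω = Equivalence.to (same-class⇔same-orbit (rep (cls ω)) ω) (cls-rep (cls ω))

    coord : Ω F n → Units
    coord ω with orbit-of ω
    ... | _ , _ , lu≡1 , _ = unit lu≡1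

    coord-• : ∀ ω → coord ω • rep (cls ω) ≡ ω
    coord-• ω with orbit-of ω
    ... | l , u , lu≡1 , act≡ω = Ω-≡ (begin
      act F l (unit lu≡1 ⁻¹) (proj₁ (rep (cls ω)))
        ≡⟨ cong (λ v → act F l v (proj₁ (rep (cls ω)))) (inverse-unique (·⁻¹≡1 (unit lu≡1)) lu≡1) ⟩
      act F l u (proj₁ (rep (cls ω)))
        ≡⟨ act≡ω ⟩
      proj₁ ω
        ∎)

    •-coord : ∀ c x → proj₁ (rep c) ≢ zeros → coord (x • rep c) ≡ x
    •-coord c x rep≢0 = •-injective (rep c) rep≢0
      (subst (λ c′ → coord ω • rep c′ ≡ ω) (trans (cls-• x (rep c)) (cls-rep c)) (coord-• ω))
      where
      ω : Ω F n
      ω = x • rep c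

    -- Padding the fixed point 0 (when 0 ∈ Ω) with a copy of F* makes every class a free orbit.
    private
      _≟ⱽ_ : DecidableEquality (Vec Carrier n)
      _≟ⱽ_ = ≡-dec _≟_

      to₁ : (ω : Ω F n) → Dec (proj₁ ω ≡ zeros) → ZeroInΩ ⊎ (Fin K × Units)
      to₁ ω (yes ω≡0) = inj₁ (zeroInΩ ω ω≡0)
      to₁ ω (no _)    = inj₂ (cls ω , coord ω)

      to : Ω F n ⊎ (ZeroInΩ × Units) → ZeroInΩ ⊎ (Fin K × Units)
      to (inj₁ ω)       = to₁ ω (proj₁ ω ≟ⱽ zeros)
      to (inj₂ (z , x)) = inj₂ (cls (zeros , z) , x)

      from₂ : ∀ c → Units → Dec (proj₁ (rep c) ≡ zeros) → Ω F n ⊎ (ZeroInΩ × Units)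
      from₂ c x (yes rep≡0) = inj₂ (zeroInΩ (rep c) rep≡0 , x)
      from₂ c x (no _)      = inj₁ (x • rep c)

      from : ZeroInΩ ⊎ (Fin K × Units) → Ω F n ⊎ (ZeroInΩ × Units)
      from (inj₁ z)       = inj₁ (zeros , z)
      from (inj₂ (c , x)) = from₂ c x (proj₁ (rep c) ≟ⱽ zeros)

      from∘to₁ : ∀ ω d → from (to₁ ω d) ≡ inj₁ ω
      from∘to₁ ω (yes ω≡0) = cong inj₁ (Ω-≡ (sym ω≡0))
      from∘to₁ ω (no ω≢0) with proj₁ (rep (cls ω)) ≟ⱽ zeros
      ... | yes rep≡0 = ⊥-elim (ω≢0 (zero-class (rep (cls ω)) ω rep≡0 (cls-rep (cls ω))))
      ... | no _      = cong inj₁ (coord-• ω)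

      from∘to : ∀ y → from (to y) ≡ y
      from∘to (inj₁ ω) = from∘to₁ ω (proj₁ ω ≟ⱽ zeros)
      from∘to (inj₂ (z , x)) with proj₁ (rep (cls (zeros , z))) ≟ⱽ zeros
      ... | yes _     = cong (λ z′ → inj₂ (z′ , x)) (≡-irrelevant _ _)
      ... | no rep≢0  =
        ⊥-elim (rep≢0 (zero-class (zeros , z) (rep (cls (zeros , z))) refl (sym (cls-rep _))))

      to∘from₂ : ∀ c x d → to (from₂ c x d) ≡ inj₂ (c , x)
      to∘from₂ c x (yes rep≡0) =
        cong (λ c′ → inj₂ (c′ , x)) (trans (cong cls (Ω-≡ (sym rep≡0))) (cls-rep c))
      to∘from₂ c x (no rep≢0) with proj₁ (x • rep c) ≟ⱽ zeros
      ... | yes x•rep≡0 = ⊥-elim (rep≢0 (zero-class (x • rep c) (rep c) x•rep≡0 (cls-• x (rep c))))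
      ... | no _        = cong inj₂ (cong₂ _,_ (trans (cls-• x (rep c)) (cls-rep c)) (•-coord c x rep≢0))

      to∘from : ∀ y → to (from y) ≡ y
      to∘from (inj₁ z) with zeros ≟ⱽ zeros
      ... | yes _  = cong inj₁ (≡-irrelevant _ _)
      ... | no 0≢0 = ⊥-elim (0≢0 refl)
      to∘from (inj₂ (c , x)) = to∘from₂ c x (proj₁ (rep c) ≟ⱽ zeros)

    decomposition : (Ω F n ⊎ (ZeroInΩ × Units)) ↔ (ZeroInΩ ⊎ (Fin K × Units))
    decomposition = mk↔ₛ′ to from to∘from from∘to

    cardinality : ∀ {N z} → Ω F n ↔ Fin N → ZeroInΩ ↔ Fin z →
                  N ℕ.+ z ℕ.* (size ∸ 1) ≡ z ℕ.+ K ℕ.* (size ∸ 1)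
    cardinality Ω↔N Z↔z = ↔⇒≡
      (⊎×↔Fin Z↔z (↔-id (Fin K)) units↔ ↔-∘ (decomposition ↔-∘ ↔-sym (⊎×↔Fin Ω↔N Z↔z units↔)))
      where
      units↔ : Units ↔ Fin (size ∸ 1)
      units↔ = punctured↔Fin _≟_ enum 0#

open import Data.Nat using (_+_; _*_)

mainTheorem11 : (F : FiniteField) (p k m : ℕ) → Prime p → p ≢ 2 →
    FiniteField.size F ≡ p ^ k → 2 ≤ m →
    (N K : ℕ) → (Ω F (2 * m) ↔ Fin N) → OrbitCount F (2 * m) K →
    (2 ∣ m → N + (FiniteField.size F ∸ 1) ≡ 1 + (FiniteField.size F ∸ 1) * K)
    × (¬ (2 ∣ m) → N ≡ (FiniteField.size F ∸ 1) * K)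
mainTheorem11 F p k m p-prime p≢2 size≡p^k _ N K Ω↔N orbits = m-even , m-odd
  where
  open FiniteField F using (size)
  open OrbitDecomposition F (act-preserves-Ω F m) orbits using (cardinality)
  open ≡-Reasoning

  q-1 : ℕ
  q-1 = size ∸ 1

  2∤size : ¬ 2 ∣ size
  2∤size = subst (λ q → ¬ 2 ∣ q) (sym size≡p^k) (¬2∣⇒¬2∣^ (prime≢2⇒¬2∣ p-prime p≢2) k)

  m-even : 2 ∣ m → N + q-1 ≡ 1 + q-1 * K
  m-even 2∣m = begin
    N + q-1      ≡⟨ cong (N +_) (ℕ.*-identityˡ q-1) ⟨
    N + 1 * q-1  ≡⟨ cardinality Ω↔N (inhabited↔Fin1 ≡-irrelevant (zeros∈Ω F 2∣m)) ⟩
    1 + K * q-1  ≡⟨ cong (1 +_) (ℕ.*-comm K q-1) ⟩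
    1 + q-1 * K  ∎

  m-odd : ¬ 2 ∣ m → N ≡ q-1 * K
  m-odd 2∤m = begin
    N            ≡⟨ ℕ.+-identityʳ N ⟨
    N + 0 * q-1  ≡⟨ cardinality Ω↔N (empty↔Fin0 (zeros∉Ω F (1+1≢0 F 2∤size) 2∤m)) ⟩
    K * q-1      ≡⟨ ℕ.*-comm K q-1 ⟩
    q-1 * K      ∎
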